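{- Let $k,n$ be positive integers with $k\le n$, and let $b_1,\dots,b_k\in\{0,1,\dots,n-1\}$ satisfy \[ 2^{b_1}+\cdots+2^{b_k}\equiv 1\pmod{2^n-1}. \] Then $2^{b_1}+\cdots+2^{b_k}=1$ or $2^{b_1}+\cdots+2^{b_k}=2^n$. -}

module Defs where

open import Data.Nat using (ℕ; _^_; _∸_)
open import Data.Fin using (Fin)
open import Data.Vec.Functional using (Vector)
open import Data.Integer using (ℤ; +_; _-_)
open import Data.Integer.Divisibility using (_∣_)

_≡_[modℕ_] : ℕ → ℕ → ℕ → Set
a ≡ b [modℕ m ] = (+ m) ∣ ((+ a) - (+ b))

sumPow2 : (k : ℕ) → (Fin k → ℕ) → ℕ
sumPow2 ℕ.zero b = 0
sumPow2 (ℕ.suc k) b = 2 ^ b Fin.zero Data.Nat.+ sumPow2 k (λ i → b (Fin.suc i))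

-- Write s = 1 + q (2^n − 1) and let the weight of s be the fewest powers 2^b, b < n, summing
-- to s, so weight s ≤ k ≤ n. If q ≥ 2 then s + (q − 1) = 2q · 2^(n−1); turning an optimal
-- representation of s plus q − 1 ones into 2q copies of 2^(n−1) needs a carry out of each of the
-- n − 1 lower places, and each carry merges two terms, so weight s + (q − 1) ≥ 2q + n − 1, that is
-- weight s > n. Hence q ≤ 1, i.e. s = 1 or s = 2^n.
module Submission where

open import Defs
open import Data.Nat using (ℕ; _≤_; _<_; zero; suc; _+_; _*_; _^_; _∸_; s≤s; s≤s⁻¹; z<s; ⌊_/2⌋)
open import Data.Nat.Properties
open import Data.Integer.Divisibility using (divides)
open import Data.Nat.Tactic.RingSolver using (solve-∀)
open import Data.Fin using (Fin)
open import Data.Sum using (_⊎_; inj₁; inj₂)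
open import Data.Empty using (⊥-elim)
open import Relation.Binary.PropositionalEquality
  using (_≡_; _≢_; refl; sym; trans; cong; cong₂; subst)

data Halves : ℕ → Set where
  even : ∀ h → Halves (2 * h)
  odd  : ∀ h → Halves (suc (2 * h))

halves : ∀ n → Halves n
halves zero = even 0
halves (suc n) with halves n
... | even h = odd h
... | odd h  = subst Halves (*-suc 2 h) (even (suc h))

lsb : ℕ → ℕ
lsb zero          = 0
lsb (suc zero)    = 1
lsb (suc (suc n)) = lsb n

lsb[2*n]≡0 : ∀ n → lsb (2 * n) ≡ 0
lsb[2*n]≡0 zero    = refl
lsb[2*n]≡0 (suc n) = trans (cong lsb (*-suc 2 n)) (lsb[2*n]≡0 n)

lsb[1+2*n]≡1 : ∀ n → lsb (suc (2 * n)) ≡ 1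
lsb[1+2*n]≡1 zero    = refl
lsb[1+2*n]≡1 (suc n) = trans (cong (λ x → lsb (suc x)) (*-suc 2 n)) (lsb[1+2*n]≡1 n)

⌊2*n/2⌋≡n : ∀ n → ⌊ 2 * n /2⌋ ≡ n
⌊2*n/2⌋≡n zero    = refl
⌊2*n/2⌋≡n (suc n) = trans (cong ⌊_/2⌋ (*-suc 2 n)) (cong suc (⌊2*n/2⌋≡n n))

⌊1+2*n/2⌋≡n : ∀ n → ⌊ suc (2 * n) /2⌋ ≡ n
⌊1+2*n/2⌋≡n zero    = refl
⌊1+2*n/2⌋≡n (suc n) = trans (cong (λ x → ⌊ suc x /2⌋) (*-suc 2 n)) (cong suc (⌊1+2*n/2⌋≡n n))

1+2*m≢2*n : ∀ m n → suc (2 * m) ≢ 2 * n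
1+2*m≢2*n m n eq with trans (sym (lsb[1+2*n]≡1 m)) (trans (cong lsb eq) (lsb[2*n]≡0 n))
... | ()

-- weight m S = ⌊S / 2^m⌋ + (number of ones among the last m binary digits of S):
-- the fewest powers 2^b with b ≤ m that sum to S.
weight : ℕ → ℕ → ℕ
weight zero    S = S
weight (suc m) S = lsb S + weight m ⌊ S /2⌋

weight-even : ∀ m n → weight (suc m) (2 * n) ≡ weight m n
weight-even m n = cong₂ _+_ (lsb[2*n]≡0 n) (cong (weight m) (⌊2*n/2⌋≡n n))

weight-odd : ∀ m n → weight (suc m) (suc (2 * n)) ≡ suc (weight m n)
weight-odd m n = cong₂ _+_ (lsb[1+2*n]≡1 n) (cong (weight m) (⌊1+2*n/2⌋≡n n))

weight-zero : ∀ m → weight m 0 ≡ 0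
weight-zero zero    = refl
weight-zero (suc m) = weight-zero m

weight-suc : ∀ m n → weight m (suc n) ≤ suc (weight m n)
weight-suc zero    n = ≤-refl
weight-suc (suc m) n with halves n
... | even h = ≤-reflexive (trans (weight-odd m h) (cong suc (sym (weight-even m h))))
... | odd h  = begin
  weight (suc m) (suc (suc (2 * h))) ≡⟨ cong (weight (suc m)) (sym (*-suc 2 h)) ⟩
  weight (suc m) (2 * suc h)         ≡⟨ weight-even m (suc h) ⟩
  weight m (suc h)                   ≤⟨ weight-suc m h ⟩
  suc (weight m h)                   ≤⟨ n≤1+n _ ⟩
  suc (suc (weight m h))             ≡⟨ cong suc (sym (weight-odd m h)) ⟩
  suc (weight (suc m) (suc (2 * h))) ∎
  where open ≤-Reasoning

weight-2^b+ : ∀ {m b} n → b ≤ m → weight m (2 ^ b + n) ≤ suc (weight m n)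
weight-2^b+ {m} {zero} n _ = weight-suc m n
weight-2^b+ {suc m} {suc b} n (s≤s b≤m) with halves n
... | even h = begin
  weight (suc m) (2 * 2 ^ b + 2 * h) ≡⟨ cong (weight (suc m)) (sym (*-distribˡ-+ 2 (2 ^ b) h)) ⟩
  weight (suc m) (2 * (2 ^ b + h))   ≡⟨ weight-even m (2 ^ b + h) ⟩
  weight m (2 ^ b + h)               ≤⟨ weight-2^b+ h b≤m ⟩
  suc (weight m h)                   ≡⟨ cong suc (sym (weight-even m h)) ⟩
  suc (weight (suc m) (2 * h))       ∎
  where open ≤-Reasoning
... | odd h = begin
  weight (suc m) (2 * 2 ^ b + suc (2 * h)) ≡⟨ cong (weight (suc m)) (regroup (2 ^ b) h) ⟩
  weight (suc m) (suc (2 * (2 ^ b + h)))   ≡⟨ weight-odd m (2 ^ b + h) ⟩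
  suc (weight m (2 ^ b + h))               ≤⟨ s≤s (weight-2^b+ h b≤m) ⟩
  suc (suc (weight m h))                   ≡⟨ cong suc (sym (weight-odd m h)) ⟩
  suc (weight (suc m) (suc (2 * h)))       ∎
  where
  open ≤-Reasoning
  regroup : ∀ x y → 2 * x + suc (2 * y) ≡ suc (2 * (x + y))
  regroup = solve-∀

weight-sumPow2 : ∀ {m} k (b : Fin k → ℕ) → (∀ i → b i ≤ m) → weight m (sumPow2 k b) ≤ k
weight-sumPow2 {m} zero    b _   = ≤-reflexive (weight-zero m)
weight-sumPow2     (suc k) b b≤m = ≤-trans (weight-2^b+ _ (b≤m Fin.zero))
  (s≤s (weight-sumPow2 k (λ i → b (Fin.suc i)) (λ i → b≤m (Fin.suc i))))

halve : ∀ m {x c} → 2 * x ≡ 2 ^ suc m * c → x ≡ 2 ^ m * c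
halve m {x} {c} eq = *-cancelˡ-≡ x (2 ^ m * c) 2 (trans eq (*-assoc 2 (2 ^ m) c))

weight-lower-bound : ∀ m {n d c} → 0 < d → n + d ≡ 2 ^ m * c → c + m ≤ weight m n + d
weight-lower-bound zero    _   eq = ≤-reflexive (sym eq)
weight-lower-bound (suc m) {n} {d} {c} d>0 eq with halves n | halves d
... | even a | even zero    = ⊥-elim (<-irrefl refl d>0)
... | even a | even (suc e) = begin
  c + suc m                      ≡⟨ +-suc c m ⟩
  suc (c + m)                    ≤⟨ s≤s ih ⟩
  suc (weight m a + suc e)       ≡⟨ sym (+-suc (weight m a) (suc e)) ⟩
  weight m a + suc (suc e)       ≤⟨ +-monoʳ-≤ (weight m a) (2+e≤2*[1+e] e) ⟩
  weight m a + 2 * suc e         ≡⟨ cong (_+ 2 * suc e) (sym (weight-even m a)) ⟩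
  weight (suc m) (2 * a) + 2 * suc e ∎
  where
  open ≤-Reasoning
  2+e≤2*[1+e] : ∀ e → 2 + e ≤ 2 * suc e
  2+e≤2*[1+e] e = ≤-trans (s≤s (s≤s (m≤m+n e (e + 0)))) (≤-reflexive (sym (*-suc 2 e)))
  ih : c + m ≤ weight m a + suc e
  ih = weight-lower-bound m z<s (halve m (trans (*-distribˡ-+ 2 a (suc e)) eq))
... | odd a | odd e = begin
  c + suc m                      ≡⟨ +-suc c m ⟩
  suc (c + m)                    ≤⟨ s≤s ih ⟩
  suc (weight m a + suc e)       ≤⟨ s≤s (+-monoʳ-≤ (weight m a) (s≤s (m≤m+n e (e + 0)))) ⟩
  suc (weight m a) + suc (2 * e) ≡⟨ cong (_+ suc (2 * e)) (sym (weight-odd m a)) ⟩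
  weight (suc m) (suc (2 * a)) + suc (2 * e) ∎
  where
  open ≤-Reasoning
  regroup : ∀ a e → suc (2 * a) + suc (2 * e) ≡ 2 * (a + suc e)
  regroup = solve-∀
  ih : c + m ≤ weight m a + suc e
  ih = weight-lower-bound m z<s (halve m (trans (sym (regroup a e)) eq))
... | even a | odd e =
  ⊥-elim (1+2*m≢2*n (a + e) (2 ^ m * c) (trans (sym (regroup a e)) (trans eq (*-assoc 2 (2 ^ m) c))))
  where
  regroup : ∀ a e → 2 * a + suc (2 * e) ≡ suc (2 * (a + e))
  regroup = solve-∀
... | odd a | even e =
  ⊥-elim (1+2*m≢2*n (a + e) (2 ^ m * c) (trans (sym (regroup a e)) (trans eq (*-assoc 2 (2 ^ m) c))))
  where
  regroup : ∀ a e → suc (2 * a) + 2 * e ≡ suc (2 * (a + e))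
  regroup = solve-∀

weight[1+q*[2^n∸1]]>n : ∀ m i → suc m < weight m (suc ((2 + i) * (2 ^ suc m ∸ 1)))
weight[1+q*[2^n∸1]]>n m i = +-cancelʳ-≤ (suc i) (suc (suc m)) _ (begin
  suc (suc m) + suc i           ≤⟨ m≤m+n _ (suc i) ⟩
  suc (suc m) + suc i + suc i   ≡⟨ regroup m i ⟩
  2 * (2 + i) + m               ≤⟨ weight-lower-bound m z<s s+q∸1≡2^m*2q ⟩
  weight m s + suc i            ∎)
  where
  open ≤-Reasoning
  regroup : ∀ m i → suc (suc m) + suc i + suc i ≡ 2 * (2 + i) + m
  regroup = solve-∀
  collect : ∀ i x → suc ((2 + i) * x) + suc i ≡ (2 + i) * suc x
  collect = solve-∀
  *-reorder : ∀ q p → q * (2 * p) ≡ p * (2 * q)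
  *-reorder = solve-∀
  N s : ℕ
  N = 2 ^ suc m ∸ 1
  s = suc ((2 + i) * N)
  s+q∸1≡2^m*2q : s + suc i ≡ 2 ^ m * (2 * (2 + i))
  s+q∸1≡2^m*2q = begin-equality
    s + suc i             ≡⟨ collect i N ⟩
    (2 + i) * suc N       ≡⟨ cong ((2 + i) *_) (suc-pred (2 ^ suc m) {{m^n≢0 2 (suc m)}}) ⟩
    (2 + i) * (2 * 2 ^ m) ≡⟨ *-reorder (2 + i) (2 ^ m) ⟩
    2 ^ m * (2 * (2 + i)) ∎

≡1-mod-2^n∸1⇒≡1⊎≡2^n : ∀ m {s} → 0 < s → weight m s ≤ suc m →
  s ≡ 1 [modℕ (2 ^ suc m ∸ 1) ] → s ≡ 1 ⊎ s ≡ 2 ^ suc m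
-- The divisibility hypothesis is ℕ-divisibility of ∣ + suc s′ - + 1 ∣, which reduces to s′.
≡1-mod-2^n∸1⇒≡1⊎≡2^n m z<s _ (divides zero refl) = inj₁ refl
≡1-mod-2^n∸1⇒≡1⊎≡2^n m z<s _ (divides 1 refl) =
  inj₂ (trans (cong suc (+-identityʳ _)) (suc-pred (2 ^ suc m) {{m^n≢0 2 (suc m)}}))
≡1-mod-2^n∸1⇒≡1⊎≡2^n m z<s w≤n (divides (suc (suc i)) refl) =
  ⊥-elim (<⇒≱ (weight[1+q*[2^n∸1]]>n m i) w≤n)

lemma3p10 : (k n : ℕ) → 1 ≤ k → k ≤ n → (b : Fin k → ℕ) → (∀ i → b i < n) →
    sumPow2 k b ≡ 1 [modℕ (2 ^ n ∸ 1) ] →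
    (sumPow2 k b ≡ 1) ⊎ (sumPow2 k b ≡ 2 ^ n)
lemma3p10 (suc k) (suc m) _ k≤n b b<n S≡1[mod] =
  ≡1-mod-2^n∸1⇒≡1⊎≡2^n m S>0 (≤-trans (weight-sumPow2 (suc k) b (λ i → s≤s⁻¹ (b<n i))) k≤n) S≡1[mod]
  where
  S>0 : 0 < sumPow2 (suc k) b
  S>0 = ≤-trans (m^n>0 2 (b Fin.zero)) (m≤m+n _ _)
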